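{- Let $p$ be a prime, $V$ an $\mathbb{F}_p$-vector space of dimension $2$ with basis $\underline{v}$, and $g\in\mathrm{GL}(V)$ semisimple and not a homothety. Then the quadratic form $Q:V\to\mathbb{F}_p$, $Q(x)=\det_{\underline{v}}(x,g\cdot x)$, is surjective onto $\mathbb{F}_p$. -}

module Defs where

open import Level using (0ℓ)
open import Data.Nat as ℕ using (ℕ; NonZero)
open import Data.Nat.DivMod using (_mod_)
open import Data.Fin using (Fin; toℕ)
open import Data.Product using (Σ; ∃; _×_; _,_)
open import Relation.Binary.PropositionalEquality using (_≡_)

Fp : (p : ℕ) → Set
Fp p = Fin p

module _ {p : ℕ} .{{_ : NonZero p}} where

  0F : Fp p
  0F = 0 mod p

  _+F_ : Fp p → Fp p → Fp p
  a +F b = (toℕ a ℕ.+ toℕ b) mod p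

  _*F_ : Fp p → Fp p → Fp p
  a *F b = (toℕ a ℕ.* toℕ b) mod p

  -F_ : Fp p → Fp p
  -F a = (p ℕ.∸ toℕ a) mod p

  _-F_ : Fp p → Fp p → Fp p
  a -F b = a +F (-F b)

  infixl 6 _+F_ _-F_
  infixl 7 _*F_

  -- V = F_p^2, written in coordinates w.r.t. the basis v = (v₁, v₂).
  V : Set
  V = Fp p × Fp p

  0V : V
  0V = 0F , 0F

  _+V_ : V → V → V
  (x₁ , x₂) +V (y₁ , y₂) = (x₁ +F y₁) , (x₂ +F y₂)

  _·V_ : Fp p → V → V
  λ' ·V (x₁ , x₂) = (λ' *F x₁) , (λ' *F x₂)

  detV : V → V → Fp p
  detV (x₁ , x₂) (y₁ , y₂) = (x₁ *F y₂) -F (x₂ *F y₁)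

  -- An endomorphism of V, given by its matrix  [ a b ; c d ]  in the basis v.
  record Mat : Set where
    constructor mat
    field a b c d : Fp p

  act : Mat → V → V
  act (mat a b c d) (x₁ , x₂) = ((a *F x₁) +F (b *F x₂)) , ((c *F x₁) +F (d *F x₂))

  detM : Mat → Fp p
  detM (mat a b c d) = (a *F d) -F (b *F c)

  IsInvertible : Mat → Set
  IsInvertible g = detM g ≡ 0F → Data.Empty.⊥
    where import Data.Empty

  IsHomothety : Mat → Set
  IsHomothety g = Σ (Fp p) λ l → ∀ (x : V) → act g x ≡ l ·V x

  record Subspace : Set₁ where
    field
      mem   : V → Set
      mem-0 : mem 0V
      mem-+ : ∀ {x y} → mem x → mem y → mem (x +V y)
      mem-· : ∀ l {x} → mem x → mem (l ·V x)
  open Subspace public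

  Stable : Mat → Subspace → Set
  Stable g W = ∀ {x} → mem W x → mem W (act g x)

  IsComplement : Subspace → Subspace → Set
  IsComplement W W' =
    (∀ {x} → mem W x → mem W' x → x ≡ 0V) ×
    (∀ (x : V) → Σ V λ w → Σ V λ w' → mem W w × mem W' w' × x ≡ (w +V w'))

  -- g is semisimple: every g-stable subspace has a g-stable complement
  -- (V is a semisimple F_p[g]-module).
  IsSemisimple : Mat → Set₁
  IsSemisimple g = ∀ (W : Subspace) → Stable g W →
    Σ Subspace λ W' → Stable g W' × IsComplement W W'

  Q : Mat → V → Fp p
  Q g x = detV x (act g x)

-- Write g = (a b ; c d).  In coordinates Q(u, v) = c u² + (d − a) u v − b v², a binary quadratic
-- form of discriminant Δ = (d − a)² + 4bc = tr(g)² − 4 det(g).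
-- For odd p, N = 2g − tr(g) commutes with g and N² = Δ.  If Δ = 0 then N² = 0; a g-stable
-- complement W′ of ker N is N-stable, so N maps it into ker N ∩ W′ = 0.  Hence N = 0 and g is a
-- homothety.  So Δ ≠ 0, and a nondegenerate binary form over F_p is surjective: completing the
-- square turns Q = K into s² − Δt² = 4cK (a linear equation if c = 0), which is solvable because
-- s² and 4cK + Δt² each take (p + 1)/2 values.
-- For p = 2, Q vanishing at e₁, e₂ and e₁ + e₂ already forces g to be a homothety.

{-# OPTIONS --safe #-}
module Submission where

open import Data.Empty using (⊥-elim)
open import Data.Fin using (Fin; toℕ; zero; suc; splitAt; join; _≟_)
open import Data.Fin.Properties using (toℕ-fromℕ<; toℕ<n; toℕ-injective; pigeonhole; join-splitAt; <⇒≢)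
open import Data.Integer as ℤ using (ℤ; +_; _+_; _*_; -_; _-_; ∣_∣; _⊖_)
open import Data.Integer.Divisibility.Signed
open import Data.Integer.DivMod using (_%ℕ_; _/ℕ_; a≡a%ℕn+[a/ℕn]*n)
import Data.Integer.Properties as ℤ
open import Data.Integer.Tactic.RingSolver using (solve-∀)
open import Data.Nat as ℕ using (ℕ; NonZero)
open import Data.Nat.Coprimality using (prime⇒coprime; coprime-Bézout)
import Data.Nat.Divisibility as ℕ
open import Data.Nat.DivMod using (_mod_; _%_; _/_; m≡m%n+[m/n]*n; m%n<n)
open import Data.Nat.GCD using (module Bézout)
open import Data.Nat.Primality using (Prime; euclidsLemma; prime⇒irreducible; ¬prime[0]; ¬prime[1])
import Data.Nat.Properties as ℕ
import Data.Nat.Tactic.RingSolver as ℕ-Solver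
open import Data.Product using (Σ; ∃; ∃₂; _×_; _,_; proj₁; proj₂)
open import Data.Sum using (_⊎_; inj₁; inj₂)
open import Function using (_∘_)
open import Relation.Binary.Bundles using (Setoid)
open import Relation.Binary.PropositionalEquality
  using (_≡_; _≢_; refl; sym; trans; cong; cong₂; subst; module ≡-Reasoning)
import Relation.Binary.Reasoning.Setoid as SetoidReasoning
open import Relation.Binary.Structures using (IsEquivalence)
open import Relation.Nullary using (¬_; yes; no)

open import Defs

form : ℤ → ℤ → ℤ → ℤ → ℤ → ℤ
form α β γ u v = α * (u * u) + β * (u * v) + γ * (v * v)

discriminant : ℤ → ℤ → ℤ → ℤ
discriminant α β γ = β * β - + 4 * (α * γ)

module Congruence (p : ℕ) .{{_ : NonZero p}} where

  P : ℤ
  P = + p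

  infix 4 _≈_
  record _≈_ (x y : ℤ) : Set where
    constructor mk≈
    field divides-difference : P ∣ x - y

  ≈-refl : ∀ {x} → x ≈ x
  ≈-refl {x} = mk≈ (divides (+ 0) (ℤ.+-inverseʳ x))

  ≈-reflexive : ∀ {x y} → x ≡ y → x ≈ y
  ≈-reflexive refl = ≈-refl

  ≈-sym : ∀ {x y} → x ≈ y → y ≈ x
  ≈-sym {x} {y} (mk≈ d) = mk≈ (subst (P ∣_) (identity x y) (∣m⇒∣-m d))
    where
    identity : ∀ x y → - (x - y) ≡ y - x
    identity = solve-∀

  ≈-trans : ∀ {x y z} → x ≈ y → y ≈ z → x ≈ z
  ≈-trans {x} {y} {z} (mk≈ d) (mk≈ e) = mk≈ (subst (P ∣_) (identity x y z) (∣m∣n⇒∣m+n d e))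
    where
    identity : ∀ x y z → (x - y) + (y - z) ≡ x - z
    identity = solve-∀

  ≈-isEquivalence : IsEquivalence _≈_
  ≈-isEquivalence = record { refl = ≈-refl ; sym = ≈-sym ; trans = ≈-trans }

  ≈-setoid : Setoid _ _
  ≈-setoid = record { isEquivalence = ≈-isEquivalence }

  module ≈-Reasoning = SetoidReasoning ≈-setoid

  +-cong : ∀ {x x′ y y′} → x ≈ x′ → y ≈ y′ → x + y ≈ x′ + y′
  +-cong {x} {x′} {y} {y′} (mk≈ d) (mk≈ e) = mk≈ (subst (P ∣_) (identity x x′ y y′) (∣m∣n⇒∣m+n d e))
    where
    identity : ∀ x x′ y y′ → (x - x′) + (y - y′) ≡ (x + y) - (x′ + y′)
    identity = solve-∀

  *-cong : ∀ {x x′ y y′} → x ≈ x′ → y ≈ y′ → x * y ≈ x′ * y′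
  *-cong {x} {x′} {y} {y′} (mk≈ d) (mk≈ e) =
    mk≈ (subst (P ∣_) (identity x x′ y y′) (∣m∣n⇒∣m+n (∣n⇒∣m*n x e) (∣m⇒∣m*n y′ d)))
    where
    identity : ∀ x x′ y y′ → x * (y - y′) + (x - x′) * y′ ≡ x * y - x′ * y′
    identity = solve-∀

  neg-cong : ∀ {x x′} → x ≈ x′ → - x ≈ - x′
  neg-cong {x} {x′} (mk≈ d) = mk≈ (subst (P ∣_) (identity x x′) (∣m⇒∣-m d))
    where
    identity : ∀ x x′ → - (x - x′) ≡ - x - - x′
    identity = solve-∀

  sub-cong : ∀ {x x′ y y′} → x ≈ x′ → y ≈ y′ → x - y ≈ x′ - y′
  sub-cong x≈x′ y≈y′ = +-cong x≈x′ (neg-cong y≈y′)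

  ∣⇒≈0 : ∀ {x} → P ∣ x → x ≈ + 0
  ∣⇒≈0 {x} d = mk≈ (subst (P ∣_) (sym (ℤ.+-identityʳ x)) d)

  +-cancelˡ-≈ : ∀ c {x y} → c + x ≈ c + y → x ≈ y
  +-cancelˡ-≈ c {x} {y} (mk≈ d) = mk≈ (subst (P ∣_) (identity c x y) d)
    where
    identity : ∀ c x y → (c + x) - (c + y) ≡ x - y
    identity = solve-∀

  x-y≈0⇒x≈y : ∀ {x y} → x - y ≈ + 0 → x ≈ y
  x-y≈0⇒x≈y {x} {y} (mk≈ d) = mk≈ (subst (P ∣_) (ℤ.+-identityʳ (x - y)) d)

  ≈0⇒∣ : ∀ {x} → x ≈ + 0 → P ∣ x
  ≈0⇒∣ {x} (mk≈ d) = subst (P ∣_) (ℤ.+-identityʳ x) d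

  x+kP≈x : ∀ x k → x + k * P ≈ x
  x+kP≈x x k = mk≈ (divides k (identity x k P))
    where
    identity : ∀ x k P → (x + k * P) - x ≡ k * P
    identity = solve-∀

  ∣-small⇒≡0 : ∀ z → ∣ z ∣ ℕ.< p → P ∣ z → z ≡ + 0
  ∣-small⇒≡0 z small d with ∣ z ∣ in eq
  ... | ℕ.zero  = ℤ.∣i∣≡0⇒i≡0 eq
  ... | ℕ.suc _ = ⊥-elim (ℕ.>⇒∤ small (subst (p ℕ.∣_) eq (∣⇒∣ᵤ d)))

  small-≈⇒≡ : ∀ {m n} → m ℕ.< p → n ℕ.< p → + m ≈ + n → m ≡ n
  small-≈⇒≡ {m} {n} m<p n<p (mk≈ d) =
    ℤ.+-injective (ℤ.i-j≡0⇒i≡j _ _ (∣-small⇒≡0 _ small d))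
    where
    small : ∣ + m - + n ∣ ℕ.< p
    small = subst (ℕ._< p) (cong ∣_∣ (sym (ℤ.m-n≡m⊖n m n)))
              (ℕ.≤-<-trans (ℤ.∣m⊝n∣≤m⊔n m n) (ℕ.⊔-pres-<m m<p n<p))

  ⟦_⟧ : Fp p → ℤ
  ⟦ a ⟧ = + toℕ a

  ⟦⟧-injective : ∀ {a b} → ⟦ a ⟧ ≈ ⟦ b ⟧ → a ≡ b
  ⟦⟧-injective {a} {b} eq = toℕ-injective (small-≈⇒≡ (toℕ<n a) (toℕ<n b) eq)

  ⟦mod⟧ : ∀ n → ⟦ n mod p ⟧ ≈ + n
  ⟦mod⟧ n = begin
    ⟦ n mod p ⟧                          ≈⟨ ≈-sym (x+kP≈x _ (+ (n / p))) ⟩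
    ⟦ n mod p ⟧ + + (n / p) * P          ≡⟨ cong₂ (λ r q → + r + q) (toℕ-fromℕ< _) (sym (ℤ.pos-* (n / p) p)) ⟩
    + (n % p) + + (n / p ℕ.* p)          ≡⟨ sym (ℤ.pos-+ (n % p) _) ⟩
    + (n % p ℕ.+ n / p ℕ.* p)            ≡⟨ cong +_ (sym (m≡m%n+[m/n]*n n p)) ⟩
    + n                                  ∎
    where open ≈-Reasoning

  ⟦0⟧ : ⟦ 0F ⟧ ≈ + 0
  ⟦0⟧ = ⟦mod⟧ 0

  ⟦+⟧ : ∀ a b → ⟦ a +F b ⟧ ≈ ⟦ a ⟧ + ⟦ b ⟧
  ⟦+⟧ a b = ≈-trans (⟦mod⟧ _) (≈-reflexive (ℤ.pos-+ (toℕ a) (toℕ b)))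

  ⟦*⟧ : ∀ a b → ⟦ a *F b ⟧ ≈ ⟦ a ⟧ * ⟦ b ⟧
  ⟦*⟧ a b = ≈-trans (⟦mod⟧ _) (≈-reflexive (ℤ.pos-* (toℕ a) (toℕ b)))

  ⟦neg⟧ : ∀ a → ⟦ -F a ⟧ ≈ - ⟦ a ⟧
  ⟦neg⟧ a = begin
    ⟦ -F a ⟧                 ≈⟨ ⟦mod⟧ _ ⟩
    + (p ℕ.∸ toℕ a)          ≡⟨ sym (ℤ.⊖-≥ (ℕ.<⇒≤ (toℕ<n a))) ⟩
    p ⊖ toℕ a                ≡⟨ sym (ℤ.m-n≡m⊖n p (toℕ a)) ⟩
    P - ⟦ a ⟧                ≡⟨ identity P ⟦ a ⟧ ⟩
    - ⟦ a ⟧ + + 1 * P        ≈⟨ x+kP≈x _ (+ 1) ⟩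
    - ⟦ a ⟧                  ∎
    where
    open ≈-Reasoning
    identity : ∀ P x → P - x ≡ - x + + 1 * P
    identity = solve-∀

  ⟦-⟧ : ∀ a b → ⟦ a -F b ⟧ ≈ ⟦ a ⟧ - ⟦ b ⟧
  ⟦-⟧ a b = ≈-trans (⟦+⟧ a (-F b)) (+-cong (≈-refl {⟦ a ⟧}) (⟦neg⟧ b))

  reduce : ℤ → Fp p
  reduce z = (z %ℕ p) mod p

  ⟦reduce⟧ : ∀ z → ⟦ reduce z ⟧ ≈ z
  ⟦reduce⟧ z = begin
    ⟦ reduce z ⟧                ≈⟨ ⟦mod⟧ _ ⟩
    + (z %ℕ p)                  ≈⟨ ≈-sym (x+kP≈x _ (z /ℕ p)) ⟩
    + (z %ℕ p) + (z /ℕ p) * P   ≡⟨ sym (a≡a%ℕn+[a/ℕn]*n z p) ⟩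
    z                           ∎
    where open ≈-Reasoning

  toℕ-reduce-≡⇒≈ : ∀ z {r} → toℕ (reduce z) ≡ r → z ≈ + r
  toℕ-reduce-≡⇒≈ z r≡ = ≈-trans (≈-sym (⟦reduce⟧ z)) (≈-reflexive (cong +_ r≡))

  reduce-≡⇒≈ : ∀ {x y} → reduce x ≡ reduce y → x ≈ y
  reduce-≡⇒≈ {x} {y} eq = ≈-trans (≈-sym (⟦reduce⟧ x)) (≈-trans (≈-reflexive (cong ⟦_⟧ eq)) (⟦reduce⟧ y))

module PrimeCongruence (p : ℕ) .{{_ : NonZero p}} (p-prime : Prime p) where

  open Congruence p

  euclid : ∀ x y → P ∣ x * y → (P ∣ x) ⊎ (P ∣ y)
  euclid x y d with euclidsLemma ∣ x ∣ ∣ y ∣ p-prime (subst (p ℕ.∣_) (ℤ.abs-* x y) (∣⇒∣ᵤ d))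
  ... | inj₁ d′ = inj₁ (∣ᵤ⇒∣ d′)
  ... | inj₂ d′ = inj₂ (∣ᵤ⇒∣ d′)

  ∤-* : ∀ {x y} → ¬ (P ∣ x) → ¬ (P ∣ y) → ¬ (P ∣ x * y)
  ∤-* {x} {y} ∤x ∤y d with euclid x y d
  ... | inj₁ d′ = ∤x d′
  ... | inj₂ d′ = ∤y d′

  ∣-cancelˡ : ∀ c {x} → ¬ (P ∣ c) → P ∣ c * x → P ∣ x
  ∣-cancelˡ c {x} ∤c d with euclid c x d
  ... | inj₁ P∣c = ⊥-elim (∤c P∣c)
  ... | inj₂ P∣x = P∣x

  *-cancelˡ-≈ : ∀ c {x y} → ¬ (P ∣ c) → c * x ≈ c * y → x ≈ y
  *-cancelˡ-≈ c {x} {y} ∤c (mk≈ d) = mk≈ (∣-cancelˡ c ∤c (subst (P ∣_) (identity c x y) d))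
    where
    identity : ∀ c x y → c * x - c * y ≡ c * (x - y)
    identity = solve-∀

  bézout⇒inverse : ∀ {r} → Bézout.Identity 1 p r → ∃ λ w → + r * w ≈ + 1
  bézout⇒inverse {r} (Bézout.Identity.+- x y eq) = - + y , (begin
    + r * - + y             ≡⟨ identity₁ (+ r) (+ y) ⟩
    + 1 - (+ 1 + + y * + r) ≡⟨ cong (λ t → + 1 - t) (pos-1+* y r) ⟩
    + 1 - + (1 ℕ.+ y ℕ.* r) ≡⟨ cong (λ t → + 1 - + t) eq ⟩
    + 1 - + (x ℕ.* p)       ≡⟨ cong (λ t → + 1 - t) (ℤ.pos-* x p) ⟩
    + 1 - + x * P           ≡⟨ identity₂ (+ x) P ⟩
    + 1 + (- + x) * P       ≈⟨ x+kP≈x (+ 1) (- + x) ⟩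
    + 1                     ∎)
    where
    open ≈-Reasoning
    pos-1+* : ∀ y r → + 1 + + y * + r ≡ + (1 ℕ.+ y ℕ.* r)
    pos-1+* y r = sym (trans (ℤ.pos-+ 1 (y ℕ.* r)) (cong (λ t → + 1 + t) (ℤ.pos-* y r)))
    identity₁ : ∀ r y → r * - y ≡ + 1 - (+ 1 + y * r)
    identity₁ = solve-∀
    identity₂ : ∀ x P → + 1 - x * P ≡ + 1 + (- x) * P
    identity₂ = solve-∀
  bézout⇒inverse {r} (Bézout.Identity.-+ x y eq) = + y , (begin
    + r * + y               ≡⟨ sym (ℤ.pos-* r y) ⟩
    + (r ℕ.* y)             ≡⟨ cong +_ (trans (ℕ.*-comm r y) (sym eq)) ⟩
    + (1 ℕ.+ x ℕ.* p)       ≡⟨ trans (ℤ.pos-+ 1 _) (cong (λ t → + 1 + t) (ℤ.pos-* x p)) ⟩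
    + 1 + + x * P           ≈⟨ x+kP≈x (+ 1) (+ x) ⟩
    + 1                     ∎)
    where open ≈-Reasoning

  inverse : ∀ z → ¬ (P ∣ z) → ∃ λ w → z * w ≈ + 1
  inverse z ∤z with toℕ (reduce z) in r≡ | toℕ<n (reduce z)
  ... | ℕ.zero  | _   = ⊥-elim (∤z (≈0⇒∣ (toℕ-reduce-≡⇒≈ z r≡)))
  ... | ℕ.suc _ | r<p with bézout⇒inverse (coprime-Bézout (prime⇒coprime p-prime r<p))
  ...   | w , rw≈1 = w , ≈-trans (*-cong (toℕ-reduce-≡⇒≈ z r≡) (≈-refl {w})) rw≈1

module OddPrimeCongruence (p : ℕ) .{{_ : NonZero p}} (p-prime : Prime p) (2<p : 2 ℕ.< p) where

  open Congruence p
  open PrimeCongruence p p-prime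

  ∤2 : ¬ (P ∣ + 2)
  ∤2 d = ℕ.>⇒∤ 2<p (∣⇒∣ᵤ d)

  half : ∃ λ h → h ℕ.+ h ≡ ℕ.suc p
  half with p % 2 | m%n<n p 2 | m≡m%n+[m/n]*n p 2
  ... | 0 | _ | p≡q*2 with prime⇒irreducible p-prime (ℕ.divides (p / 2) p≡q*2)
  ...   | inj₁ ()
  ...   | inj₂ refl = ⊥-elim (ℕ.<-irrefl refl 2<p)
  half | 1 | _ | p≡1+q*2 = ℕ.suc (p / 2) , trans (identity (p / 2)) (cong ℕ.suc (sym p≡1+q*2))
    where
    identity : ∀ q → ℕ.suc q ℕ.+ ℕ.suc q ≡ ℕ.suc (1 ℕ.+ q ℕ.* 2)
    identity = ℕ-Solver.solve-∀
  half | ℕ.suc (ℕ.suc _) | ℕ.s≤s (ℕ.s≤s ()) | _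

  x+x≈0⇒x≈0 : ∀ {x} → x + x ≈ + 0 → x ≈ + 0
  x+x≈0⇒x≈0 {x} x+x≈0 = ∣⇒≈0 (∣-cancelˡ (+ 2) ∤2 (subst (P ∣_) (identity x) (≈0⇒∣ x+x≈0)))
    where
    identity : ∀ x → x + x ≡ + 2 * x
    identity = solve-∀

  sq : ℕ → ℤ
  sq n = + n * + n

  module _ {h} (h+h≡1+p : h ℕ.+ h ≡ ℕ.suc p) where

    +-<-half : ∀ {m n} → m ℕ.< h → n ℕ.< h → m ℕ.+ n ℕ.< p
    +-<-half {m} {n} m<h n<h = ℕ.s≤s⁻¹ (subst (ℕ.suc (m ℕ.+ n) ℕ.<_) h+h≡1+p
      (subst (ℕ._≤ h ℕ.+ h) (ℕ.+-suc (ℕ.suc m) n) (ℕ.+-mono-≤ m<h n<h)))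

    sq-injective : ∀ {m n} → m ℕ.< h → n ℕ.< h → sq m ≈ sq n → m ≡ n
    sq-injective {m} {n} m<h n<h (mk≈ d) with euclid (+ m - + n) (+ m + + n) (subst (P ∣_) (identity (+ m) (+ n)) d)
      where
      identity : ∀ m n → m * m - n * n ≡ (m - n) * (m + n)
      identity = solve-∀
    ... | inj₁ d′ = small-≈⇒≡ (ℕ.≤-<-trans (ℕ.m≤m+n m n) m+n<p) (ℕ.≤-<-trans (ℕ.m≤n+m n m) m+n<p) (mk≈ d′)
      where
      m+n<p : m ℕ.+ n ℕ.< p
      m+n<p = +-<-half m<h n<h
    ... | inj₂ d′ = trans (ℕ.m+n≡0⇒m≡0 m m+n≡0) (sym (ℕ.m+n≡0⇒n≡0 m m+n≡0))
      where
      m+n≡0 : m ℕ.+ n ≡ 0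
      m+n≡0 = ℤ.+-injective (∣-small⇒≡0 _ (+-<-half m<h n<h) (subst (P ∣_) (sym (ℤ.pos-+ m n)) d′))

  module _ (Δ : ℤ) (∤Δ : ¬ (P ∣ Δ)) (M : ℤ) {h} (h+h≡1+p : h ℕ.+ h ≡ ℕ.suc p) where

    private
      Solution : Set
      Solution = ∃₂ λ s t → s * s - Δ * (t * t) ≈ M

      p<h+h : p ℕ.< h ℕ.+ h
      p<h+h = subst (p ℕ.<_) (sym h+h≡1+p) (ℕ.n<1+n p)

      value : Fin h ⊎ Fin h → ℤ
      value (inj₁ s) = sq (toℕ s)
      value (inj₂ t) = M + Δ * sq (toℕ t)

      sq-injective′ : ∀ {s s′ : Fin h} → sq (toℕ s) ≈ sq (toℕ s′) → s ≡ s′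
      sq-injective′ {s} {s′} eq = toℕ-injective (sq-injective h+h≡1+p (toℕ<n s) (toℕ<n s′) eq)

      solved : ∀ {S T} → S ≈ M + Δ * T → S - Δ * T ≈ M
      solved {S} {T} eq = ≈-trans (sub-cong eq (≈-refl {Δ * T})) (≈-reflexive (identity M (Δ * T)))
        where
        identity : ∀ M X → (M + X) - X ≡ M
        identity = solve-∀

      collision : ∀ x y → x ≢ y → value x ≈ value y → Solution
      collision (inj₁ s) (inj₁ s′) x≢y eq = ⊥-elim (x≢y (cong inj₁ (sq-injective′ eq)))
      collision (inj₂ t) (inj₂ t′) x≢y eq =
        ⊥-elim (x≢y (cong inj₂ (sq-injective′ (*-cancelˡ-≈ Δ ∤Δ (+-cancelˡ-≈ M eq)))))
      collision (inj₁ s) (inj₂ t) _ eq = + toℕ s , + toℕ t , solved eq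
      collision (inj₂ t) (inj₁ s) _ eq = + toℕ s , + toℕ t , solved (≈-sym eq)

    -- The 2h = p + 1 residues s² and M + Δt² (s, t < h) cannot be distinct, and neither
    -- family repeats a value.
    pigeonhole-solution : Solution
    pigeonhole-solution with pigeonhole p<h+h (reduce ∘ value ∘ splitAt h)
    ... | i , j , i<j , fi≡fj = collision (splitAt h i) (splitAt h j) (splitAt-distinct (<⇒≢ i<j)) (reduce-≡⇒≈ fi≡fj)
      where
      splitAt-distinct : i ≢ j → splitAt h i ≢ splitAt h j
      splitAt-distinct i≢j e = i≢j (trans (sym (join-splitAt h h i)) (trans (cong (join h h) e) (join-splitAt h h j)))

  s²-Δt²-surjective : ∀ Δ → ¬ (P ∣ Δ) → ∀ M → ∃₂ λ s t → s * s - Δ * (t * t) ≈ M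
  s²-Δt²-surjective Δ ∤Δ M = pigeonhole-solution Δ ∤Δ M {proj₁ half} (proj₂ half)

  form-surjective-∣α : ∀ α β γ → ¬ (P ∣ discriminant α β γ) → P ∣ α → ∀ K → ∃₂ λ u v → form α β γ u v ≈ K
  form-surjective-∣α α β γ ∤disc P∣α K = u , + 1 , (begin
    form α β γ u (+ 1)                               ≈⟨ +-cong (+-cong (*-cong (∣⇒≈0 P∣α) (≈-refl {u * u})) ≈-refl) ≈-refl ⟩
    + 0 * (u * u) + β * (u * + 1) + γ * (+ 1 * + 1)  ≡⟨ identity₁ (u * u) β (K - γ) w γ ⟩
    (K - γ) * (β * w) + γ                            ≈⟨ +-cong (*-cong (≈-refl {K - γ}) βw≈1) ≈-refl ⟩
    (K - γ) * + 1 + γ                                ≡⟨ identity₂ K γ ⟩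
    K                                                ∎)
    where
    open ≈-Reasoning
    ∤β : ¬ (P ∣ β)
    ∤β P∣β = ∤disc (∣m∣n⇒∣m-n (∣m⇒∣m*n β P∣β) (∣n⇒∣m*n (+ 4) (∣m⇒∣m*n γ P∣α)))
    w = proj₁ (inverse β ∤β)
    βw≈1 = proj₂ (inverse β ∤β)
    u = (K - γ) * w
    identity₁ : ∀ U β k w γ → + 0 * U + β * ((k * w) * + 1) + γ * (+ 1 * + 1) ≡ k * (β * w) + γ
    identity₁ = solve-∀
    identity₂ : ∀ K γ → (K - γ) * + 1 + γ ≡ K
    identity₂ = solve-∀

  form-surjective-∤α : ∀ α β γ → ¬ (P ∣ discriminant α β γ) → ¬ (P ∣ α) → ∀ K → ∃₂ λ u v → form α β γ u v ≈ K
  form-surjective-∤α α β γ ∤disc ∤α K = u , t , *-cancelˡ-≈ (+ 2 * (+ 2 * α)) (∤-* ∤2 ∤2α) (begin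
    + 2 * (+ 2 * α) * form α β γ u t                              ≡⟨ completing-the-square α β γ u t ⟩
    (+ 2 * α * u + β * t) * (+ 2 * α * u + β * t) - Δ * (t * t)   ≈⟨ sub-cong (*-cong linear linear) (≈-refl {Δ * (t * t)}) ⟩
    s * s - Δ * (t * t)                                          ≈⟨ st ⟩
    + 2 * (+ 2 * α) * K                                          ∎)
    where
    open ≈-Reasoning
    Δ = discriminant α β γ
    ∤2α : ¬ (P ∣ + 2 * α)
    ∤2α = ∤-* ∤2 ∤α
    w = proj₁ (inverse (+ 2 * α) ∤2α)
    2αw≈1 = proj₂ (inverse (+ 2 * α) ∤2α)
    solution = s²-Δt²-surjective Δ ∤disc (+ 2 * (+ 2 * α) * K)
    s = proj₁ solution
    t = proj₁ (proj₂ solution)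
    st = proj₂ (proj₂ solution)
    u = (s - β * t) * w
    completing-the-square : ∀ α β γ u t →
      + 2 * (+ 2 * α) * (α * (u * u) + β * (u * t) + γ * (t * t)) ≡
      (+ 2 * α * u + β * t) * (+ 2 * α * u + β * t) - (β * β - + 4 * (α * γ)) * (t * t)
    completing-the-square = solve-∀
    linear : + 2 * α * u + β * t ≈ s
    linear = begin
      + 2 * α * ((s - β * t) * w) + β * t  ≡⟨ identity₁ (+ 2 * α) (s - β * t) w (β * t) ⟩
      (s - β * t) * (+ 2 * α * w) + β * t  ≈⟨ +-cong (*-cong (≈-refl {s - β * t}) 2αw≈1) ≈-refl ⟩
      (s - β * t) * + 1 + β * t            ≡⟨ identity₂ s (β * t) ⟩
      s                                    ∎
      where
      identity₁ : ∀ a x w y → a * (x * w) + y ≡ x * (a * w) + y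
      identity₁ = solve-∀
      identity₂ : ∀ s y → (s - y) * + 1 + y ≡ s
      identity₂ = solve-∀

  form-surjective : ∀ α β γ → ¬ (P ∣ discriminant α β γ) → ∀ K → ∃₂ λ u v → form α β γ u v ≈ K
  form-surjective α β γ ∤disc with P ∣? α
  ... | yes P∣α = form-surjective-∣α α β γ ∤disc P∣α
  ... | no ∤α   = form-surjective-∤α α β γ ∤disc ∤α

module Coordinates (p : ℕ) .{{_ : NonZero p}} where

  open Congruence p

  infix 4 _≃⟨_,_⟩
  record _≃⟨_,_⟩ (x : V {p}) (X₁ X₂ : ℤ) : Set where
    constructor lifted
    field
      fst : ⟦ proj₁ x ⟧ ≈ X₁
      snd : ⟦ proj₂ x ⟧ ≈ X₂

  ≃-lift : ∀ x → x ≃⟨ ⟦ proj₁ x ⟧ , ⟦ proj₂ x ⟧ ⟩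
  ≃-lift x = lifted ≈-refl ≈-refl

  ≃-≡ : ∀ {x y X₁ X₂ Y₁ Y₂} → x ≃⟨ X₁ , X₂ ⟩ → y ≃⟨ Y₁ , Y₂ ⟩ → X₁ ≈ Y₁ → X₂ ≈ Y₂ → x ≡ y
  ≃-≡ {_ , _} {_ , _} (lifted x₁ x₂) (lifted y₁ y₂) e₁ e₂ =
    cong₂ _,_ (⟦⟧-injective (≈-trans x₁ (≈-trans e₁ (≈-sym y₁))))
              (⟦⟧-injective (≈-trans x₂ (≈-trans e₂ (≈-sym y₂))))

  0V-≃ : 0V ≃⟨ + 0 , + 0 ⟩
  0V-≃ = lifted ⟦0⟧ ⟦0⟧

  ≡0V⇒≈0 : ∀ {x X₁ X₂} → x ≡ 0V → x ≃⟨ X₁ , X₂ ⟩ → X₁ ≈ + 0 × X₂ ≈ + 0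
  ≡0V⇒≈0 refl (lifted x₁ x₂) = ≈-trans (≈-sym x₁) ⟦0⟧ , ≈-trans (≈-sym x₂) ⟦0⟧

  +V-≃ : ∀ {x y X₁ X₂ Y₁ Y₂} → x ≃⟨ X₁ , X₂ ⟩ → y ≃⟨ Y₁ , Y₂ ⟩ → x +V y ≃⟨ X₁ + Y₁ , X₂ + Y₂ ⟩
  +V-≃ {x₁ , x₂} {y₁ , y₂} (lifted h₁ h₂) (lifted k₁ k₂) =
    lifted (≈-trans (⟦+⟧ x₁ y₁) (+-cong h₁ k₁)) (≈-trans (⟦+⟧ x₂ y₂) (+-cong h₂ k₂))

  ·V-≃ : ∀ l {L x X₁ X₂} → ⟦ l ⟧ ≈ L → x ≃⟨ X₁ , X₂ ⟩ → l ·V x ≃⟨ L * X₁ , L * X₂ ⟩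
  ·V-≃ l {x = x₁ , x₂} hl (lifted h₁ h₂) =
    lifted (≈-trans (⟦*⟧ l x₁) (*-cong hl h₁)) (≈-trans (⟦*⟧ l x₂) (*-cong hl h₂))

  act-≃ : ∀ a b c d {A B C D x X₁ X₂} → ⟦ a ⟧ ≈ A → ⟦ b ⟧ ≈ B → ⟦ c ⟧ ≈ C → ⟦ d ⟧ ≈ D →
          x ≃⟨ X₁ , X₂ ⟩ → act (mat a b c d) x ≃⟨ A * X₁ + B * X₂ , C * X₁ + D * X₂ ⟩
  act-≃ a b c d {x = x₁ , x₂} ha hb hc hd (lifted h₁ h₂) = lifted
    (≈-trans (⟦+⟧ (a *F x₁) (b *F x₂)) (+-cong (≈-trans (⟦*⟧ a x₁) (*-cong ha h₁)) (≈-trans (⟦*⟧ b x₂) (*-cong hb h₂))))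
    (≈-trans (⟦+⟧ (c *F x₁) (d *F x₂)) (+-cong (≈-trans (⟦*⟧ c x₁) (*-cong hc h₁)) (≈-trans (⟦*⟧ d x₂) (*-cong hd h₂))))

  act-lift : ∀ a b c d {x X₁ X₂} → x ≃⟨ X₁ , X₂ ⟩ →
             act (mat a b c d) x ≃⟨ ⟦ a ⟧ * X₁ + ⟦ b ⟧ * X₂ , ⟦ c ⟧ * X₁ + ⟦ d ⟧ * X₂ ⟩
  act-lift a b c d = act-≃ a b c d (≈-refl {⟦ a ⟧}) (≈-refl {⟦ b ⟧}) (≈-refl {⟦ c ⟧}) (≈-refl {⟦ d ⟧})

  detV-≃ : ∀ {x y X₁ X₂ Y₁ Y₂} → x ≃⟨ X₁ , X₂ ⟩ → y ≃⟨ Y₁ , Y₂ ⟩ → ⟦ detV x y ⟧ ≈ X₁ * Y₂ - X₂ * Y₁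
  detV-≃ {x₁ , x₂} {y₁ , y₂} (lifted h₁ h₂) (lifted k₁ k₂) = ≈-trans (⟦-⟧ (x₁ *F y₂) (x₂ *F y₁))
    (sub-cong (≈-trans (⟦*⟧ x₁ y₂) (*-cong h₁ k₂)) (≈-trans (⟦*⟧ x₂ y₁) (*-cong h₂ k₁)))

  +V-identityˡ : ∀ x → 0V +V x ≡ x
  +V-identityˡ x = ≃-≡ (+V-≃ 0V-≃ (≃-lift x)) (≃-lift x)
    (≈-reflexive (ℤ.+-identityˡ _)) (≈-reflexive (ℤ.+-identityˡ _))

  ·V-zeroʳ : ∀ l → l ·V 0V ≡ 0V
  ·V-zeroʳ l = ≃-≡ (·V-≃ l (≈-refl {⟦ l ⟧}) 0V-≃) 0V-≃
    (≈-reflexive (ℤ.*-zeroʳ ⟦ l ⟧)) (≈-reflexive (ℤ.*-zeroʳ ⟦ l ⟧))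

  act-0V : ∀ g → act g 0V ≡ 0V
  act-0V (mat a b c d) = ≃-≡ (act-lift a b c d 0V-≃) 0V-≃
    (≈-reflexive (identity ⟦ a ⟧ ⟦ b ⟧)) (≈-reflexive (identity ⟦ c ⟧ ⟦ d ⟧))
    where
    identity : ∀ A B → A * + 0 + B * + 0 ≡ + 0
    identity = solve-∀

  act-+V : ∀ g x y → act g (x +V y) ≡ act g x +V act g y
  act-+V (mat a b c d) x y =
    ≃-≡ (act-lift a b c d (+V-≃ (≃-lift x) (≃-lift y))) (+V-≃ (act-lift a b c d (≃-lift x)) (act-lift a b c d (≃-lift y)))
      (≈-reflexive (identity ⟦ a ⟧ ⟦ b ⟧ X₁ X₂ Y₁ Y₂)) (≈-reflexive (identity ⟦ c ⟧ ⟦ d ⟧ X₁ X₂ Y₁ Y₂))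
    where
    X₁ = ⟦ proj₁ x ⟧
    X₂ = ⟦ proj₂ x ⟧
    Y₁ = ⟦ proj₁ y ⟧
    Y₂ = ⟦ proj₂ y ⟧
    identity : ∀ A B X₁ X₂ Y₁ Y₂ → A * (X₁ + Y₁) + B * (X₂ + Y₂) ≡ (A * X₁ + B * X₂) + (A * Y₁ + B * Y₂)
    identity = solve-∀

  act-·V : ∀ g l x → act g (l ·V x) ≡ l ·V act g x
  act-·V (mat a b c d) l x =
    ≃-≡ (act-lift a b c d (·V-≃ l (≈-refl {⟦ l ⟧}) (≃-lift x))) (·V-≃ l (≈-refl {⟦ l ⟧}) (act-lift a b c d (≃-lift x)))
      (≈-reflexive (identity ⟦ a ⟧ ⟦ b ⟧ ⟦ l ⟧ X₁ X₂)) (≈-reflexive (identity ⟦ c ⟧ ⟦ d ⟧ ⟦ l ⟧ X₁ X₂))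
    where
    X₁ = ⟦ proj₁ x ⟧
    X₂ = ⟦ proj₂ x ⟧
    identity : ∀ A B L X₁ X₂ → A * (L * X₁) + B * (L * X₂) ≡ L * (A * X₁ + B * X₂)
    identity = solve-∀

  kernel : Mat {p} → Subspace
  kernel n = record
    { mem   = λ x → act n x ≡ 0V
    ; mem-0 = act-0V n
    ; mem-+ = λ {x} {y} nx≡0 ny≡0 →
        trans (act-+V n x y) (trans (cong₂ _+V_ nx≡0 ny≡0) (+V-identityˡ 0V))
    ; mem-· = λ l {x} nx≡0 → trans (act-·V n l x) (trans (cong (l ·V_) nx≡0) (·V-zeroʳ l))
    }

  1F : Fp p
  1F = 1 mod p

  ⟦1⟧ : ⟦ 1F ⟧ ≈ + 1
  ⟦1⟧ = ⟦mod⟧ 1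

  e₁ e₂ : V {p}
  e₁ = 1F , 0F
  e₂ = 0F , 1F

  e₁-≃ : e₁ ≃⟨ + 1 , + 0 ⟩
  e₁-≃ = lifted ⟦1⟧ ⟦0⟧

  e₂-≃ : e₂ ≃⟨ + 0 , + 1 ⟩
  e₂-≃ = lifted ⟦0⟧ ⟦1⟧

  scalar⇒homothety : ∀ a b c d → ⟦ b ⟧ ≈ + 0 → ⟦ c ⟧ ≈ + 0 → ⟦ d ⟧ ≈ ⟦ a ⟧ → IsHomothety (mat a b c d)
  scalar⇒homothety a b c d b≈0 c≈0 d≈a = a , act≡a·
    where
    identity₁ : ∀ A X₁ X₂ → A * X₁ + + 0 * X₂ ≡ A * X₁
    identity₁ = solve-∀
    identity₂ : ∀ A X₁ X₂ → + 0 * X₁ + A * X₂ ≡ A * X₂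
    identity₂ = solve-∀
    act≡a· : ∀ x → act (mat a b c d) x ≡ a ·V x
    act≡a· x = ≃-≡ (act-≃ a b c d ≈-refl b≈0 c≈0 d≈a (≃-lift x)) (·V-≃ a (≈-refl {⟦ a ⟧}) (≃-lift x))
      (≈-reflexive (identity₁ ⟦ a ⟧ ⟦ proj₁ x ⟧ ⟦ proj₂ x ⟧)) (≈-reflexive (identity₂ ⟦ a ⟧ ⟦ proj₁ x ⟧ ⟦ proj₂ x ⟧))

  Q-≃ : ∀ a b c d {x X₁ X₂} → x ≃⟨ X₁ , X₂ ⟩ →
        ⟦ Q (mat a b c d) x ⟧ ≈ form ⟦ c ⟧ (⟦ d ⟧ - ⟦ a ⟧) (- ⟦ b ⟧) X₁ X₂
  Q-≃ a b c d {X₁ = X₁} {X₂} x≃ = ≈-trans (detV-≃ x≃ (act-lift a b c d x≃))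
    (≈-reflexive (identity ⟦ a ⟧ ⟦ b ⟧ ⟦ c ⟧ ⟦ d ⟧ X₁ X₂))
    where
    identity : ∀ A B C D X₁ X₂ →
      X₁ * (C * X₁ + D * X₂) - X₂ * (A * X₁ + B * X₂) ≡ C * (X₁ * X₁) + (D - A) * (X₁ * X₂) + (- B) * (X₂ * X₂)
    identity = solve-∀

  Q-0V : ∀ g → Q g 0V ≡ 0F
  Q-0V (mat a b c d) = ⟦⟧-injective (≈-trans (Q-≃ a b c d 0V-≃) (≈-trans (≈-reflexive (identity ⟦ c ⟧ (⟦ d ⟧ - ⟦ a ⟧) (- ⟦ b ⟧))) (≈-sym ⟦0⟧)))
    where
    identity : ∀ α β γ → α * (+ 0 * + 0) + β * (+ 0 * + 0) + γ * (+ 0 * + 0) ≡ + 0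
    identity = solve-∀

  isotropic-basis⇒homothety : ∀ g → Q g e₁ ≡ 0F → Q g e₂ ≡ 0F → Q g (e₁ +V e₂) ≡ 0F → IsHomothety g
  isotropic-basis⇒homothety (mat a b c d) q₁ q₂ q₃ = scalar⇒homothety a b c d b≈0 c≈0 d≈a
    where
    open ≈-Reasoning
    A = ⟦ a ⟧
    B = ⟦ b ⟧
    C = ⟦ c ⟧
    D = ⟦ d ⟧
    vanishes : ∀ {x X₁ X₂} → x ≃⟨ X₁ , X₂ ⟩ → Q (mat a b c d) x ≡ 0F → form C (D - A) (- B) X₁ X₂ ≈ + 0
    vanishes x≃ q = ≈-trans (≈-sym (Q-≃ a b c d x≃)) (≈-trans (≈-reflexive (cong ⟦_⟧ q)) ⟦0⟧)
    identity₁ : ∀ α β γ → α ≡ α * (+ 1 * + 1) + β * (+ 1 * + 0) + γ * (+ 0 * + 0)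
    identity₁ = solve-∀
    identity₂ : ∀ α β B → B ≡ - (α * (+ 0 * + 0) + β * (+ 0 * + 1) + (- B) * (+ 1 * + 1))
    identity₂ = solve-∀
    identity₃ : ∀ A B C D → D ≡ C * ((+ 1 + + 0) * (+ 1 + + 0)) + (D - A) * ((+ 1 + + 0) * (+ 0 + + 1))
                                 + (- B) * ((+ 0 + + 1) * (+ 0 + + 1)) - C + B + A
    identity₃ = solve-∀
    c≈0 : C ≈ + 0
    c≈0 = ≈-trans (≈-reflexive (identity₁ C (D - A) (- B))) (vanishes e₁-≃ q₁)
    b≈0 : B ≈ + 0
    b≈0 = ≈-trans (≈-reflexive (identity₂ C (D - A) B)) (neg-cong (vanishes e₂-≃ q₂))
    d≈a : D ≈ A
    d≈a = begin
      D                                                          ≡⟨ identity₃ A B C D ⟩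
      form C (D - A) (- B) (+ 1 + + 0) (+ 0 + + 1) - C + B + A  ≈⟨ +-cong (+-cong (sub-cong (vanishes (+V-≃ e₁-≃ e₂-≃) q₃) c≈0) b≈0) (≈-refl {A}) ⟩
      + 0 - + 0 + + 0 + A                                        ≡⟨ ℤ.+-identityˡ A ⟩
      A                                                          ∎

  anisotropic-vector : ∀ g → ¬ IsHomothety g → ∃ λ x → Q g x ≢ 0F
  anisotropic-vector g not-homothety with Q g e₁ ≟ 0F | Q g e₂ ≟ 0F | Q g (e₁ +V e₂) ≟ 0F
  ... | no q₁  | _      | _      = e₁ , q₁
  ... | yes _  | no q₂  | _      = e₂ , q₂
  ... | yes _  | yes _  | no q₃  = e₁ +V e₂ , q₃
  ... | yes q₁ | yes q₂ | yes q₃ = ⊥-elim (not-homothety (isotropic-basis⇒homothety g q₁ q₂ q₃))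

module F₂ where

  open Coordinates 2

  Q-surjective : (g : Mat {2}) → ¬ IsHomothety g → (k : Fp 2) → Σ (V {2}) λ x → Q g x ≡ k
  Q-surjective g _ zero = 0V , Q-0V g
  Q-surjective g not-homothety (suc zero) with anisotropic-vector g not-homothety
  ... | x , q≢0 with Q g x in q
  ...   | zero     = ⊥-elim (q≢0 refl)
  ...   | suc zero = x , q

module Semisimple (p : ℕ) .{{_ : NonZero p}} where

  open Coordinates p

  kernel-stable : ∀ g n → (∀ x → act n (act g x) ≡ act g (act n x)) → Stable g (kernel n)
  kernel-stable g n commutes {y} ny≡0 = trans (commutes y) (trans (cong (act g) ny≡0) (act-0V g))

  square-zero⇒zero : ∀ g → IsSemisimple g → ∀ n → (∀ {W} → Stable g W → Stable n W) →
                     (∀ x → act n (act g x) ≡ act g (act n x)) → (∀ x → act n (act n x) ≡ 0V) →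
                     ∀ x → act n x ≡ 0V
  square-zero⇒zero g semisimple n preserves commutes n²≡0 x = begin
    act n x                ≡⟨ cong (act n) x≡w+w′ ⟩
    act n (w +V w′)        ≡⟨ act-+V n w w′ ⟩
    act n w +V act n w′    ≡⟨ cong₂ _+V_ nw≡0 nw′≡0 ⟩
    0V +V 0V               ≡⟨ +V-identityˡ 0V ⟩
    0V                     ∎
    where
    open ≡-Reasoning
    complement = semisimple (kernel n) (kernel-stable g n commutes)
    W′ : Subspace
    W′ = proj₁ complement
    decomposition = proj₂ (proj₂ (proj₂ complement)) x
    w w′ : V
    w = proj₁ decomposition
    w′ = proj₁ (proj₂ decomposition)
    nw≡0 : act n w ≡ 0V
    nw≡0 = proj₁ (proj₂ (proj₂ decomposition))
    x≡w+w′ : x ≡ w +V w′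
    x≡w+w′ = proj₂ (proj₂ (proj₂ (proj₂ decomposition)))
    nw′∈W′ : mem W′ (act n w′)
    nw′∈W′ = preserves {W′} (proj₁ (proj₂ complement)) {w′} (proj₁ (proj₂ (proj₂ (proj₂ decomposition))))
    nw′≡0 : act n w′ ≡ 0V
    nw′≡0 = proj₁ (proj₂ (proj₂ complement)) {act n w′} (n²≡0 w′) nw′∈W′

module OddPrime (p : ℕ) .{{_ : NonZero p}} (p-prime : Prime p) (2<p : 2 ℕ.< p) where

  open Congruence p
  open OddPrimeCongruence p p-prime 2<p
  open Coordinates p
  open Semisimple p

  twiceTraceless : Mat {p} → Mat {p}
  twiceTraceless (mat a b c d) = mat (a -F d) (b +F b) (c +F c) (d -F a)

  module _ (a b c d : Fp p) where

    private
      g = mat a b c d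
      n = twiceTraceless g
      A = ⟦ a ⟧
      B = ⟦ b ⟧
      C = ⟦ c ⟧
      D = ⟦ d ⟧

      n-≃ : ∀ {x X₁ X₂} → x ≃⟨ X₁ , X₂ ⟩ → act n x ≃⟨ (A - D) * X₁ + (B + B) * X₂ , (C + C) * X₁ + (D - A) * X₂ ⟩
      n-≃ = act-≃ (a -F d) (b +F b) (c +F c) (d -F a) (⟦-⟧ a d) (⟦+⟧ b b) (⟦+⟧ c c) (⟦-⟧ d a)

    twiceTraceless-commutes : ∀ x → act n (act g x) ≡ act g (act n x)
    twiceTraceless-commutes x =
      ≃-≡ (n-≃ (act-lift a b c d (≃-lift x))) (act-lift a b c d (n-≃ (≃-lift x)))
        (≈-reflexive (identity₁ A B C D X₁ X₂)) (≈-reflexive (identity₂ A B C D X₁ X₂))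
      where
      X₁ = ⟦ proj₁ x ⟧
      X₂ = ⟦ proj₂ x ⟧
      identity₁ : ∀ A B C D X₁ X₂ → (A - D) * (A * X₁ + B * X₂) + (B + B) * (C * X₁ + D * X₂) ≡
                                    A * ((A - D) * X₁ + (B + B) * X₂) + B * ((C + C) * X₁ + (D - A) * X₂)
      identity₁ = solve-∀
      identity₂ : ∀ A B C D X₁ X₂ → (C + C) * (A * X₁ + B * X₂) + (D - A) * (C * X₁ + D * X₂) ≡
                                    C * ((A - D) * X₁ + (B + B) * X₂) + D * ((C + C) * X₁ + (D - A) * X₂)
      identity₂ = solve-∀

    twiceTraceless-preserves : ∀ {W} → Stable g W → Stable n W
    twiceTraceless-preserves {W} g-stable {x} x∈W = subst (mem W) (sym n≡2g-t)
      (mem-+ W (mem-+ W (g-stable x∈W) (g-stable x∈W)) (mem-· W (-F (a +F d)) x∈W))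
      where
      X₁ = ⟦ proj₁ x ⟧
      X₂ = ⟦ proj₂ x ⟧
      n≡2g-t : act n x ≡ (act g x +V act g x) +V ((-F (a +F d)) ·V x)
      n≡2g-t = ≃-≡ (n-≃ (≃-lift x))
        (+V-≃ (+V-≃ (act-lift a b c d (≃-lift x)) (act-lift a b c d (≃-lift x)))
              (·V-≃ (-F (a +F d)) (≈-trans (⟦neg⟧ (a +F d)) (neg-cong (⟦+⟧ a d))) (≃-lift x)))
        (≈-reflexive (identity₁ A B C D X₁ X₂)) (≈-reflexive (identity₂ A B C D X₁ X₂))
        where
        identity₁ : ∀ A B C D X₁ X₂ → (A - D) * X₁ + (B + B) * X₂ ≡ ((A * X₁ + B * X₂) + (A * X₁ + B * X₂)) + (- (A + D)) * X₁
        identity₁ = solve-∀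
        identity₂ : ∀ A B C D X₁ X₂ → (C + C) * X₁ + (D - A) * X₂ ≡ ((C * X₁ + D * X₂) + (C * X₁ + D * X₂)) + (- (A + D)) * X₂
        identity₂ = solve-∀

    twiceTraceless-square : P ∣ discriminant C (D - A) (- B) → ∀ x → act n (act n x) ≡ 0V
    twiceTraceless-square P∣Δ x = ≃-≡ (n-≃ (n-≃ (≃-lift x))) 0V-≃
      (≈-trans (≈-reflexive (identity₁ A B C D X₁ X₂)) (∣⇒≈0 (∣m⇒∣m*n X₁ P∣Δ)))
      (≈-trans (≈-reflexive (identity₂ A B C D X₁ X₂)) (∣⇒≈0 (∣m⇒∣m*n X₂ P∣Δ)))
      where
      X₁ = ⟦ proj₁ x ⟧
      X₂ = ⟦ proj₂ x ⟧
      identity₁ : ∀ A B C D X₁ X₂ → (A - D) * ((A - D) * X₁ + (B + B) * X₂) + (B + B) * ((C + C) * X₁ + (D - A) * X₂) ≡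
                                    ((D - A) * (D - A) - + 4 * (C * (- B))) * X₁
      identity₁ = solve-∀
      identity₂ : ∀ A B C D X₁ X₂ → (C + C) * ((A - D) * X₁ + (B + B) * X₂) + (D - A) * ((C + C) * X₁ + (D - A) * X₂) ≡
                                    ((D - A) * (D - A) - + 4 * (C * (- B))) * X₂
      identity₂ = solve-∀

    semisimple-degenerate⇒homothety : IsSemisimple g → P ∣ discriminant C (D - A) (- B) → IsHomothety g
    semisimple-degenerate⇒homothety semisimple P∣Δ = scalar⇒homothety a b c d
      (x+x≈0⇒x≈0 (≈-trans (≈-reflexive (identity₂ (A - D) (B + B))) (proj₁ ne₂)))
      (x+x≈0⇒x≈0 (≈-trans (≈-reflexive (identity₁ (C + C) (D - A))) (proj₂ ne₁)))
      (≈-sym (x-y≈0⇒x≈y (≈-trans (≈-reflexive (identity₁ (A - D) (B + B))) (proj₁ ne₁))))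
      where
      n≡0 : ∀ x → act n x ≡ 0V
      n≡0 = square-zero⇒zero g semisimple n (λ {W} → twiceTraceless-preserves {W}) twiceTraceless-commutes (twiceTraceless-square P∣Δ)
      ne₁ : (A - D) * + 1 + (B + B) * + 0 ≈ + 0 × (C + C) * + 1 + (D - A) * + 0 ≈ + 0
      ne₁ = ≡0V⇒≈0 (n≡0 e₁) (n-≃ e₁-≃)
      ne₂ : (A - D) * + 0 + (B + B) * + 1 ≈ + 0 × (C + C) * + 0 + (D - A) * + 1 ≈ + 0
      ne₂ = ≡0V⇒≈0 (n≡0 e₂) (n-≃ e₂-≃)
      identity₁ : ∀ X Y → X ≡ X * + 1 + Y * + 0
      identity₁ = solve-∀
      identity₂ : ∀ X Y → Y ≡ X * + 0 + Y * + 1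
      identity₂ = solve-∀

  Q-surjective : ∀ g → IsSemisimple g → ¬ IsHomothety g → (k : Fp p) → Σ (V {p}) λ x → Q g x ≡ k
  Q-surjective (mat a b c d) semisimple not-homothety k = (reduce u , reduce v) ,
    ⟦⟧-injective (≈-trans (Q-≃ a b c d (lifted (⟦reduce⟧ u) (⟦reduce⟧ v))) q≈k)
    where
    nondegenerate : ¬ (P ∣ discriminant ⟦ c ⟧ (⟦ d ⟧ - ⟦ a ⟧) (- ⟦ b ⟧))
    nondegenerate = not-homothety ∘ semisimple-degenerate⇒homothety a b c d semisimple
    solution = form-surjective ⟦ c ⟧ (⟦ d ⟧ - ⟦ a ⟧) (- ⟦ b ⟧) nondegenerate ⟦ k ⟧
    u v : ℤ
    u = proj₁ solution
    v = proj₁ (proj₂ solution)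
    q≈k : form ⟦ c ⟧ (⟦ d ⟧ - ⟦ a ⟧) (- ⟦ b ⟧) u v ≈ ⟦ k ⟧
    q≈k = proj₂ (proj₂ solution)

lemma4p3 : (p : ℕ) .{{_ : NonZero p}} → Prime p →
    (g : Mat {p}) → IsInvertible g → IsSemisimple g → ¬ IsHomothety g →
    (c : Fp p) → Σ (V {p}) λ x → Q g x ≡ c
lemma4p3 0 p-prime = ⊥-elim (¬prime[0] p-prime)
lemma4p3 1 p-prime = ⊥-elim (¬prime[1] p-prime)
lemma4p3 2 _ g _ _ not-homothety = F₂.Q-surjective g not-homothety
lemma4p3 p@(ℕ.suc (ℕ.suc (ℕ.suc _))) p-prime g _ semisimple not-homothety =
  OddPrime.Q-surjective p p-prime (ℕ.s≤s (ℕ.s≤s (ℕ.s≤s ℕ.z≤n))) g semisimple not-homothety
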